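{- Let $\Delta$ be a nontrivial $q$-matroid complex on $\mathbb{F}_q^n$ of dimension $d\ge2$. Then its order complex $K(\Delta)$ is not a matroid complex; that is, there is no matroid on the ground set $\Delta$ whose independent sets are exactly the chains of $\Delta$.
   Context: A $q$-matroid on $E=\mathbb{F}_q^n$ is a function $\rho$ from the set of subspaces of $E$ to $\mathbb{N}$ such that $0\le\rho(U)\le\dim U$; $U\subseteq V$ implies $\rho(U)\le\rho(V)$; and $\rho(U+V)+\rho(U\cap V)\le\rho(U)+\rho(V)$. A subspace $U$ is independent if $\rho(U)=\dim U$. The $q$-matroid complex of $\rho$ is the set $\Delta$ of independent subspaces; it is closed under taking subspaces, its maximal elements (facets) are the bases, and its dimension is the maximal dimension of its elements. "Nontrivial" means that $\Delta$ has at least two distinct facets. The order complex $K(\Delta)$ is the simplicial complex on vertex set $\Delta$ whose faces are the chains (subsets totally ordered by inclusion) of $\Delta$. -}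

module Defs where

open import Level using (Level; 0ℓ) renaming (suc to lsuc; _⊔_ to _⊔ℓ_)
open import Algebra.Bundles using (CommutativeRing)
import Algebra.Properties.CommutativeSemigroup as CSProps
open import Data.Nat using (ℕ; zero; suc; _+_; _≤_; _<_)
open import Data.Fin using (Fin)
import Data.Fin as Fin
open import Data.List using (List; []; _∷_; length)
open import Data.List.Relation.Unary.Any using (Any)
open import Data.List.Relation.Unary.AllPairs using (AllPairs)
open import Data.Product using (Σ; ∃; ∃₂; _×_; _,_; proj₁; proj₂)
open import Data.Sum using (_⊎_)
open import Relation.Nullary using (¬_)
open import Relation.Binary using (Decidable)
open import Function using (_∘_)
open import Function.Bundles using (_⇔_)

-- F_q is any such field.

record FiniteField : Set₁ where
  field
    ring : CommutativeRing 0ℓ 0ℓ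
  open CommutativeRing ring
  field
    1≉0      : ¬ (1# ≈ 0#)
    inverse  : ∀ x → ¬ (x ≈ 0#) → ∃ λ y → (x * y) ≈ 1#
    _≟_      : Decidable _≈_
    elements : List Carrier
    complete : ∀ x → Any (x ≈_) elements

-- Matroids on a ground set A (with equality _~_), given by independent
-- sets.  Finite subsets of A are represented by duplicate-free lists.

module _ {a : Level} {A : Set a} (_~_ : A → A → Set a) where

  _∈ₛ_ : A → List A → Set a
  x ∈ₛ L = Any (x ~_) L

  Distinct : List A → Set a
  Distinct = AllPairs (λ x y → ¬ (x ~ y))

  _⊆ₛ_ : List A → List A → Set a
  L ⊆ₛ M = ∀ x → x ∈ₛ L → x ∈ₛ M

  record Matroid : Set (lsuc a) where
    field
      Indep      : List A → Set a
      indep-∅    : Indep []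
      hereditary : ∀ L M → Distinct L → Distinct M → L ⊆ₛ M → Indep M → Indep L
      augment    : ∀ L M → Distinct L → Distinct M → Indep L → Indep M →
                   length L < length M →
                   ∃ λ x → x ∈ₛ M × ¬ (x ∈ₛ L) × Indep (x ∷ L)

module QMatroidDefs (F : FiniteField) (n : ℕ) where
  open FiniteField F
  open CommutativeRing ring renaming (_+_ to _+F_; _*_ to _*F_)
  open CSProps +-commutativeSemigroup using (interchange)

  Vector : Set
  Vector = Fin n → Carrier

  _≋_ : Vector → Vector → Set
  u ≋ v = ∀ i → u i ≈ v i

  0V : Vector
  0V _ = 0#

  _+V_ : Vector → Vector → Vector
  (u +V v) i = u i +F v i

  _·V_ : Carrier → Vector → Vector
  (c ·V v) i = c *F v i

  record Subspace : Set₁ where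
    field
      Mem      : Vector → Set
      Mem-resp : ∀ {u v} → u ≋ v → Mem u → Mem v
      Mem-0    : Mem 0V
      Mem-+    : ∀ {u v} → Mem u → Mem v → Mem (u +V v)
      Mem-·    : ∀ c {v} → Mem v → Mem (c ·V v)
  open Subspace public

  _⊆V_ : Subspace → Subspace → Set
  U ⊆V V = ∀ v → Mem U v → Mem V v

  _≐_ : Subspace → Subspace → Set
  U ≐ V = (U ⊆V V) × (V ⊆V U)

  _⊕_ : Subspace → Subspace → Subspace
  U ⊕ V = record
    { Mem      = λ w → ∃₂ λ u v → Mem U u × Mem V v × w ≋ (u +V v)
    ; Mem-resp = λ { e (u , v , mu , mv , e') → u , v , mu , mv , (λ i → trans (sym (e i)) (e' i)) }
    ; Mem-0    = 0V , 0V , Mem-0 U , Mem-0 V , (λ i → sym (+-identityʳ 0#))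
    ; Mem-+    = λ { (u , v , mu , mv , e) (u' , v' , mu' , mv' , e') →
                     (u +V u') , (v +V v') , Mem-+ U mu mu' , Mem-+ V mv mv'
                     , (λ i → trans (+-cong (e i) (e' i)) (interchange (u i) (v i) (u' i) (v' i))) }
    ; Mem-·    = λ { c (u , v , mu , mv , e) →
                     (c ·V u) , (c ·V v) , Mem-· U c mu , Mem-· V c mv
                     , (λ i → trans (*-congˡ (e i)) (distribˡ c (u i) (v i))) }
    }

  _∩V_ : Subspace → Subspace → Subspace
  U ∩V V = record
    { Mem      = λ w → Mem U w × Mem V w
    ; Mem-resp = λ e (mu , mv) → Mem-resp U e mu , Mem-resp V e mv
    ; Mem-0    = Mem-0 U , Mem-0 V
    ; Mem-+    = λ (mu , mv) (mu' , mv') → Mem-+ U mu mu' , Mem-+ V mv mv'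
    ; Mem-·    = λ c (mu , mv) → Mem-· U c mu , Mem-· V c mv
    }

  lincomb : ∀ {k} → (Fin k → Carrier) → (Fin k → Vector) → Vector
  lincomb {zero}  c vs = 0V
  lincomb {suc k} c vs = (c Fin.zero ·V vs Fin.zero) +V lincomb (c ∘ Fin.suc) (vs ∘ Fin.suc)

  LinIndep : ∀ {k} → (Fin k → Vector) → Set
  LinIndep {k} vs = ∀ c → lincomb c vs ≋ 0V → ∀ i → c i ≈ 0#

  HasDim : Subspace → ℕ → Set
  HasDim U k = Σ (Fin k → Vector) λ vs →
                 (∀ i → Mem U (vs i)) × LinIndep vs ×
                 (∀ u → Mem U u → ∃ λ c → u ≋ lincomb c vs)

  -- q-matroid rank function axioms (0 ≤ ρ U is automatic in ℕ)
  record IsQMatroid (ρ : Subspace → ℕ) : Set₁ where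
    field
      rank-≤-dim    : ∀ U k → HasDim U k → ρ U ≤ k
      rank-mono     : ∀ U V → U ⊆V V → ρ U ≤ ρ V
      rank-submod   : ∀ U V → ρ (U ⊕ V) + ρ (U ∩V V) ≤ ρ U + ρ V

  module _ (ρ : Subspace → ℕ) where

    Independent : Subspace → Set
    Independent U = HasDim U (ρ U)

    Δ : Set₁
    Δ = Σ Subspace Independent

    _≐Δ_ : Δ → Δ → Set
    (U , _) ≐Δ (V , _) = U ≐ V

    _⊆Δ_ : Δ → Δ → Set
    (U , _) ⊆Δ (V , _) = U ⊆V V

    IsFacet : Subspace → Set₁
    IsFacet B = Independent B × (∀ V → Independent V → B ⊆V V → V ⊆V B)

    Nontrivial : Set₁
    Nontrivial = Σ Subspace λ B₁ → Σ Subspace λ B₂ →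
                   IsFacet B₁ × IsFacet B₂ × ¬ (B₁ ≐ B₂)

    ComplexDim : ℕ → Set₁
    ComplexDim d = (Σ Subspace λ U → Independent U × HasDim U d)
                 × (∀ U k → Independent U → HasDim U k → k ≤ d)

    -- chains of Δ (faces of the order complex K(Δ)); a finite subset of Δ
    -- is a duplicate-free list of elements of Δ
    IsChain : List Δ → Set₁
    IsChain = AllPairs (λ x y → (x ⊆Δ y) ⊎ (y ⊆Δ x))

    OrderComplexIsMatroid : Set₂
    OrderComplexIsMatroid =
      Σ (Matroid {A = Δ} (λ x y → Lift₁ (x ≐Δ y))) λ M →
        ∀ L → Distinct (λ x y → Lift₁ (x ≐Δ y)) L →
          Matroid.Indep M L ⇔ IsChain L
      where
        Lift₁ : Set → Set₁
        Lift₁ = Level.Lift (lsuc 0ℓ)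

{-# OPTIONS --safe #-}
-- If K(Δ) were a matroid, augmenting a one-element chain {Y} from a two-element chain {X ⊂ Z}
-- would show that everything strictly below Z lies below every Y incomparable to Z.  The lines
-- spanned by a basis of an independent Z are independent (submodularity forces them to have
-- rank 1), so Z ⊆ Y would follow unless Z lies in a line.  Two distinct facets are incomparable;
-- if the first lies in a line, it is incomparable to an independent subspace of dimension d ≥ 2,
-- and such a subspace lies in no line.

module Submission where

open import Defs
open import Data.Nat using (ℕ; zero; suc; _+_; _≤_; z≤n; s≤s)
open import Relation.Nullary using (¬_)

open import Level using (_⊔_; 0ℓ; Lift; lift) renaming (suc to lsuc)
open import Data.Nat.Properties
  using (≤-trans; ≤-antisym; m≤m+n; +-cancelʳ-≤; +-cancelˡ-≤; +-monoˡ-≤; +-monoʳ-≤)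
open import Data.Fin using (Fin; zero; suc)
open import Data.List using ([]; _∷_)
open import Data.List.Relation.Unary.All using ([]; _∷_)
open import Data.List.Relation.Unary.AllPairs using (AllPairs; []; _∷_)
open import Data.List.Relation.Unary.Any using (here; there)
open import Data.Product using (∃; _×_; _,_; proj₁; proj₂)
open import Data.Sum using (_⊎_; inj₁; inj₂)
open import Data.Empty using (⊥-elim)
open import Relation.Binary.PropositionalEquality using (_≡_; subst) renaming (sym to ≡-sym)
open import Function using (_∘_)
open import Function.Bundles using (_⇔_; Equivalence)
open import Algebra.Bundles using (CommutativeRing)
import Algebra.Properties.Ring as RingProperties
import Algebra.Properties.CommutativeSemigroup as CommutativeSemigroupProperties

+-≤-tight : ∀ {a b m k} → a ≤ m → b ≤ k → m + k ≤ a + b → (a ≡ m) × (b ≡ k)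
+-≤-tight {a} {b} {m} {k} a≤m b≤k m+k≤a+b =
  ≤-antisym a≤m (+-cancelʳ-≤ k m a (≤-trans m+k≤a+b (+-monoʳ-≤ a b≤k))) ,
  ≤-antisym b≤k (+-cancelˡ-≤ m k b (≤-trans m+k≤a+b (+-monoˡ-≤ b a≤m)))

module ChainMatroid {a ℓ} {A : Set a} (_~_ : A → A → Set a) (_≤_ : A → A → Set ℓ)
  (≤-trans : ∀ {x y z} → x ≤ y → y ≤ z → x ≤ z)
  (~⇒≤≥ : ∀ {x y} → x ~ y → (x ≤ y) × (y ≤ x)) where

  Comparable : A → A → Set ℓ
  Comparable x y = x ≤ y ⊎ y ≤ x

  IndepIsChain : Matroid _~_ → Set (a ⊔ ℓ)
  IndepIsChain M = ∀ L → Distinct _~_ L → Matroid.Indep M L ⇔ AllPairs Comparable L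

  -- Augment the chain [y] from the chain [x, z]: z is incomparable to y, so x must be comparable to y.
  strictly-below⇒below-incomparable : (M : Matroid _~_) → IndepIsChain M → ∀ {x y z} →
    x ≤ z → ¬ (z ≤ x) → ¬ (y ≤ z) → ¬ (z ≤ y) → x ≤ y
  strictly-below⇒below-incomparable M indep⇔chain {x} {y} {z} x≤z z≰x y≰z z≰y
    with Matroid.augment M (y ∷ []) (x ∷ z ∷ []) ([] ∷ []) x≁z-distinct
           (chain⇒indep ([] ∷ []) ([] ∷ []))
           (chain⇒indep x≁z-distinct ((inj₁ x≤z ∷ []) ∷ [] ∷ [])) (s≤s (s≤s z≤n))
    where
      chain⇒indep : ∀ {L} → Distinct _~_ L → AllPairs Comparable L → Matroid.Indep M L
      chain⇒indep {L} d = Equivalence.from (indep⇔chain L d)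
      x≁z-distinct : Distinct _~_ (x ∷ z ∷ [])
      x≁z-distinct = ((z≰x ∘ proj₂ ∘ ~⇒≤≥) ∷ []) ∷ [] ∷ []
  ... | e , e∈xz , e∉y , indep-ey
    with e∈xz | Equivalence.to (indep⇔chain (e ∷ y ∷ []) (((e∉y ∘ here) ∷ []) ∷ [] ∷ [])) indep-ey
  ... | here e~x         | (inj₁ e≤y ∷ []) ∷ _ = ≤-trans (proj₂ (~⇒≤≥ e~x)) e≤y
  ... | here e~x         | (inj₂ y≤e ∷ []) ∷ _ =
    ⊥-elim (y≰z (≤-trans y≤e (≤-trans (proj₁ (~⇒≤≥ e~x)) x≤z)))
  ... | there (here e~z) | (inj₁ e≤y ∷ []) ∷ _ = ⊥-elim (z≰y (≤-trans (proj₂ (~⇒≤≥ e~z)) e≤y))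
  ... | there (here e~z) | (inj₂ y≤e ∷ []) ∷ _ = ⊥-elim (y≰z (≤-trans y≤e (proj₁ (~⇒≤≥ e~z))))

module LinearAlgebra (F : FiniteField) (n : ℕ) where
  open QMatroidDefs F n
  open FiniteField F using (ring; 1≉0)
  open CommutativeRing ring renaming (_+_ to _+F_; _*_ to _*F_) hiding (ring; zero)
  open RingProperties (CommutativeRing.ring ring) using (-‿distribˡ-*)
  open CommutativeSemigroupProperties +-commutativeSemigroup using (interchange)

  ⊆V-trans : ∀ {U V W} → U ⊆V V → V ⊆V W → U ⊆V W
  ⊆V-trans U⊆V V⊆W u = V⊆W u ∘ U⊆V u

  lincomb-0 : ∀ {k} (vs : Fin k → Vector) → lincomb (λ _ → 0#) vs ≋ 0V
  lincomb-0 {zero}  vs i = refl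
  lincomb-0 {suc k} vs i = trans (+-cong (zeroˡ _) (lincomb-0 (vs ∘ suc) i)) (+-identityʳ 0#)

  lincomb-+ : ∀ {k} (c c′ : Fin k → Carrier) (vs : Fin k → Vector) →
              lincomb (λ j → c j +F c′ j) vs ≋ (lincomb c vs +V lincomb c′ vs)
  lincomb-+ {zero}  c c′ vs i = sym (+-identityʳ 0#)
  lincomb-+ {suc k} c c′ vs i =
    trans (+-cong (distribʳ (vs zero i) (c zero) (c′ zero))
                  (lincomb-+ (c ∘ suc) (c′ ∘ suc) (vs ∘ suc) i))
          (interchange _ _ _ _)

  lincomb-· : ∀ {k} (a : Carrier) (c : Fin k → Carrier) (vs : Fin k → Vector) →
              lincomb (λ j → a *F c j) vs ≋ (a ·V lincomb c vs)
  lincomb-· {zero}  a c vs i = sym (zeroʳ a)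
  lincomb-· {suc k} a c vs i =
    trans (+-cong (*-assoc _ _ _) (lincomb-· a (c ∘ suc) (vs ∘ suc) i)) (sym (distribˡ a _ _))

  δ : ∀ {k} → Fin k → Fin k → Carrier
  δ zero    zero    = 1#
  δ zero    (suc _) = 0#
  δ (suc _) zero    = 0#
  δ (suc i) (suc j) = δ i j

  lincomb-δ : ∀ {k} (vs : Fin k → Vector) i → lincomb (δ i) vs ≋ vs i
  lincomb-δ vs zero    j = trans (+-cong (*-identityˡ _) (lincomb-0 (vs ∘ suc) j)) (+-identityʳ _)
  lincomb-δ vs (suc i) j = trans (+-cong (zeroˡ _) (lincomb-δ (vs ∘ suc) i j)) (+-identityˡ _)

  Span : ∀ {k} → (Fin k → Vector) → Subspace
  Span vs = record
    { Mem      = λ w → ∃ λ c → w ≋ lincomb c vs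
    ; Mem-resp = λ { u≋v (c , u≋) → c , λ i → trans (sym (u≋v i)) (u≋ i) }
    ; Mem-0    = (λ _ → 0#) , λ i → sym (lincomb-0 vs i)
    ; Mem-+    = λ { (c , u≋) (c′ , v≋) →
                   (λ j → c j +F c′ j) , λ i → trans (+-cong (u≋ i) (v≋ i)) (sym (lincomb-+ c c′ vs i)) }
    ; Mem-·    = λ { a (c , v≋) →
                   (λ j → a *F c j) , λ i → trans (*-congˡ (v≋ i)) (sym (lincomb-· a c vs i)) }
    }

  Line : Vector → Subspace
  Line v = Span {1} (λ _ → v)

  Span-∋ : ∀ {k} (vs : Fin k → Vector) i → Mem (Span vs) (vs i)
  Span-∋ vs i = δ i , λ j → sym (lincomb-δ vs i j)

  lincomb-∈ : ∀ {k} (Y : Subspace) {vs : Fin k → Vector} → (∀ j → Mem Y (vs j)) →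
              ∀ c → Mem Y (lincomb c vs)
  lincomb-∈ {zero}  Y vs∈Y c = Mem-0 Y
  lincomb-∈ {suc k} Y vs∈Y c =
    Mem-+ Y (Mem-· Y (c zero) (vs∈Y zero)) (lincomb-∈ Y (vs∈Y ∘ suc) (c ∘ suc))

  Span-⊆ : ∀ {k} (Y : Subspace) {vs : Fin k → Vector} → (∀ j → Mem Y (vs j)) → Span vs ⊆V Y
  Span-⊆ Y vs∈Y v (c , v≋) = Mem-resp Y (λ i → sym (v≋ i)) (lincomb-∈ Y vs∈Y c)

  HasDim-Span : ∀ {k} (vs : Fin k → Vector) → LinIndep vs → HasDim (Span vs) k
  HasDim-Span vs li = vs , Span-∋ vs , li , λ _ v∈Span → v∈Span

  Span-cons-⊆ : ∀ {k} (vs : Fin (suc k) → Vector) → Span vs ⊆V (Line (vs zero) ⊕ Span (vs ∘ suc))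
  Span-cons-⊆ vs w (c , w≋) =
    lincomb {1} (λ _ → c zero) (λ _ → vs zero) , lincomb (c ∘ suc) (vs ∘ suc) ,
    ((λ _ → c zero) , λ _ → refl) , ((c ∘ suc) , λ _ → refl) ,
    λ i → trans (w≋ i) (+-cong (sym (+-identityʳ _)) refl)

  LinIndep-head : ∀ {k} (vs : Fin (suc k) → Vector) → LinIndep vs → LinIndep {1} (λ _ → vs zero)
  LinIndep-head vs li c c·v≈0 zero =
    li head-only (λ i → trans (+-cong refl (lincomb-0 (vs ∘ suc) i)) (c·v≈0 i)) zero
    where
      head-only : Fin _ → Carrier
      head-only zero    = c zero
      head-only (suc _) = 0#

  LinIndep-tail : ∀ {k} (vs : Fin (suc k) → Vector) → LinIndep vs → LinIndep (vs ∘ suc)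
  LinIndep-tail vs li c lc≈0 j =
    li tail-only (λ i → trans (+-cong (zeroˡ _) (lc≈0 i)) (+-identityʳ 0#)) (suc j)
    where
      tail-only : Fin _ → Carrier
      tail-only zero    = 0#
      tail-only (suc j) = c j

  -- With v₀ = a w and v₁ = b w, the relation b v₀ - a v₁ = 0 forces b = 0, hence v₁ = 0.
  ¬LinIndep⊆Line : ∀ {k} w (vs : Fin (suc (suc k)) → Vector) → LinIndep vs →
                   ¬ (∀ i → Mem (Line w) (vs i))
  ¬LinIndep⊆Line w vs li vs∈Line = 1≉0 (li (δ v₁) (λ i → trans (lincomb-δ vs v₁ i) (v₁≈0 i)) v₁)
    where
      v₁ = suc zero
      a = proj₁ (vs∈Line zero) zero
      b = proj₁ (vs∈Line v₁) zero
      v₀≈aw : ∀ i → vs zero i ≈ a *F w i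
      v₀≈aw i = trans (proj₂ (vs∈Line zero) i) (+-identityʳ _)
      v₁≈bw : ∀ i → vs v₁ i ≈ b *F w i
      v₁≈bw i = trans (proj₂ (vs∈Line v₁) i) (+-identityʳ _)
      relation : Fin _ → Carrier
      relation zero          = b
      relation (suc zero)    = - a
      relation (suc (suc _)) = 0#
      cancel : ∀ x → (b *F (a *F x) +F (- a) *F (b *F x)) ≈ 0#
      cancel x = trans (+-cong (trans (sym (*-assoc b a x)) (trans (*-congʳ (*-comm b a)) (*-assoc a b x)))
                               (sym (-‿distribˡ-* a (b *F x))))
                       (-‿inverseʳ (a *F (b *F x)))
      relation-holds : lincomb relation vs ≋ 0V
      relation-holds i =
        trans (+-cong (*-congˡ (v₀≈aw i))
                      (+-cong (*-congˡ (v₁≈bw i)) (lincomb-0 (λ j → vs (suc (suc j))) i)))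
              (trans (+-cong refl (+-identityʳ _)) (cancel (w i)))
      v₁≈0 : vs v₁ ≋ 0V
      v₁≈0 i = trans (v₁≈bw i) (trans (*-congʳ (li relation relation-holds zero)) (zeroˡ _))

  InNoLine : Subspace → Set
  InNoLine Z = ∀ w → ¬ (Z ⊆V Line w)

  HasDim-2+⇒InNoLine : ∀ {Z k} → HasDim Z (suc (suc k)) → InNoLine Z
  HasDim-2+⇒InNoLine (vs , vs∈Z , li , _) w Z⊆Line =
    ¬LinIndep⊆Line w vs li (λ i → Z⊆Line (vs i) (vs∈Z i))

  module Rank {ρ : Subspace → ℕ} (isQ : IsQMatroid ρ) where
    open IsQMatroid isQ

    rank-Span-cons-≤ : ∀ {k} (vs : Fin (suc k) → Vector) →
                       ρ (Span vs) ≤ ρ (Line (vs zero)) + ρ (Span (vs ∘ suc))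
    rank-Span-cons-≤ vs =
      ≤-trans (rank-mono _ _ (Span-cons-⊆ vs)) (≤-trans (m≤m+n _ _) (rank-submod _ _))

    rank-Span-cons : ∀ {k} (vs : Fin (suc k) → Vector) → LinIndep vs → ρ (Span vs) ≡ suc k →
                     (ρ (Line (vs zero)) ≡ 1) × (ρ (Span (vs ∘ suc)) ≡ k)
    rank-Span-cons {k} vs li ρ≡1+k =
      +-≤-tight (rank-≤-dim _ 1 (HasDim-Span (λ _ → vs zero) (LinIndep-head vs li)))
                (rank-≤-dim _ k (HasDim-Span _ (LinIndep-tail vs li)))
                (subst (_≤ ρ (Line (vs zero)) + ρ (Span (vs ∘ suc))) ρ≡1+k (rank-Span-cons-≤ vs))

    Independent-Line : ∀ {k} (vs : Fin k → Vector) → LinIndep vs → ρ (Span vs) ≡ k →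
                       ∀ i → Independent ρ (Line (vs i))
    Independent-Line vs li ρ≡k zero =
      subst (HasDim (Line (vs zero))) (≡-sym (proj₁ (rank-Span-cons vs li ρ≡k)))
            (HasDim-Span (λ _ → vs zero) (LinIndep-head vs li))
    Independent-Line vs li ρ≡k (suc i) =
      Independent-Line (vs ∘ suc) (LinIndep-tail vs li) (proj₂ (rank-Span-cons vs li ρ≡k)) i

    Independent-Line-basis : ∀ {Z} (indZ : Independent ρ Z) i → Independent ρ (Line (proj₁ indZ i))
    Independent-Line-basis {Z} (vs , vs∈Z , li , Z⊆Span) =
      Independent-Line vs li (≤-antisym (rank-mono _ _ (Span-⊆ Z vs∈Z)) (rank-mono _ _ Z⊆Span))

    open ChainMatroid {A = Δ ρ} (λ x y → Lift (lsuc 0ℓ) (_≐Δ_ ρ x y)) (_⊆Δ_ ρ)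
                      (λ x⊆y y⊆z u → y⊆z u ∘ x⊆y u) (λ (lift x≐y) → x≐y)

    incomparable⇒¬InNoLine : OrderComplexIsMatroid ρ → ∀ {Y Z} → Independent ρ Y → Independent ρ Z →
                             ¬ (Y ⊆V Z) → ¬ (Z ⊆V Y) → ¬ InNoLine Z
    incomparable⇒¬InNoLine (M , indep⇔chain) {Y} {Z} indY indZ@(vs , vs∈Z , _ , Z⊆Span)
                           Y⊈Z Z⊈Y Z-in-no-line =
      Z⊈Y (⊆V-trans {Z} {Span vs} {Y} Z⊆Span (Span-⊆ Y vs∈Y))
      where
        vs∈Y : ∀ i → Mem Y (vs i)
        vs∈Y i = strictly-below⇒below-incomparable M indep⇔chain
                   {x = Line (vs i) , Independent-Line-basis indZ i} {y = Y , indY} {z = Z , indZ}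
                   (Span-⊆ Z {λ _ → vs i} (λ _ → vs∈Z i)) (Z-in-no-line (vs i)) Y⊈Z Z⊈Y
                   (vs i) (Span-∋ (λ _ → vs i) zero)

proposition2p20 : (F : FiniteField) (n : ℕ) (ρ : QMatroidDefs.Subspace F n → ℕ) →
    QMatroidDefs.IsQMatroid F n ρ → QMatroidDefs.Nontrivial F n ρ →
    (d : ℕ) → 2 ≤ d → QMatroidDefs.ComplexDim F n ρ d →
    ¬ QMatroidDefs.OrderComplexIsMatroid F n ρ
proposition2p20 F n ρ isQ (B₁ , B₂ , (indB₁ , maxB₁) , (indB₂ , maxB₂) , B₁≉B₂)
                (suc (suc d)) (s≤s (s≤s z≤n)) ((U , indU , dimU) , _) K-matroid =
  incomparable⇒¬InNoLine K-matroid indB₂ indB₁ B₂⊈B₁ B₁⊈B₂ B₁-in-no-line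
  where
    open QMatroidDefs F n
    open LinearAlgebra F n
    open Rank isQ

    B₁⊈B₂ : ¬ (B₁ ⊆V B₂)
    B₁⊈B₂ B₁⊆B₂ = B₁≉B₂ (B₁⊆B₂ , maxB₁ B₂ indB₂ B₁⊆B₂)

    B₂⊈B₁ : ¬ (B₂ ⊆V B₁)
    B₂⊈B₁ B₂⊆B₁ = B₁≉B₂ (maxB₂ B₁ indB₁ B₂⊆B₁ , B₂⊆B₁)

    U-in-no-line : InNoLine U
    U-in-no-line = HasDim-2+⇒InNoLine {U} {d} dimU

    B₁-in-no-line : InNoLine B₁
    B₁-in-no-line w B₁⊆w = incomparable⇒¬InNoLine K-matroid indB₁ indU
      (λ B₁⊆U → U-in-no-line w (⊆V-trans {U} {B₁} {Line w} (maxB₁ U indU B₁⊆U) B₁⊆w))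
      (λ U⊆B₁ → U-in-no-line w (⊆V-trans {U} {B₁} {Line w} U⊆B₁ B₁⊆w))
      U-in-no-line
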